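{- Let $k\ge1$ and $R\ge1$ be integers. Let $1<m_1\le m_2\le\cdots\le m_R$ be integers, let $\{1,\ldots,R\}=J_1\cup\cdots\cup J_k$ be a decomposition into pairwise disjoint (possibly empty) sets, and let $a_1,\ldots,a_k,b_1,\ldots,b_k\ge1$ be integers with $a_i\ge b_i$ for all $i$. Suppose that \[ \sum_{i=1}^{k}\frac{b_i}{a_i}\prod_{\substack{1\le j\le R\\ j\in J_i}}\left(1-\frac{1}{m_j}\right)\le1 \quad\text{and}\quad \sum_{i=1}^{k}\frac{b_i}{a_i}\prod_{\substack{1\le j\le R-1\\ j\in J_i}}\left(1-\frac{1}{m_j}\right)>1. \] Then \[ a\prod_{j=1}^{R}m_j\le F_R(a+1), \] where $a=a_1\cdots a_k$.
   Context: For an integer $r\ge1$ and real $x\ge1$, $F_r(x)=x^{2^r}-x^{2^{r-1}}$; also $F_0(x)=x-1$. Empty products equal $1$. -}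

module Defs where

open import Data.Nat as ℕ using (ℕ; zero; suc; _∸_; _^_; _<ᵇ_)
open import Data.Fin using (Fin; toℕ) renaming (zero to fzero; suc to fsuc)
open import Data.Fin.Properties using () renaming (_≟_ to _≟ᶠ_)
open import Data.Integer using (+_)
open import Data.Rational using (ℚ; 0ℚ; 1ℚ; _/_; _+_; _*_; _-_)
open import Data.Bool using (Bool; if_then_else_; _∧_)
open import Relation.Nullary.Decidable using (⌊_⌋)

-- F_0(x) = x - 1, F_r(x) = x^(2^r) - x^(2^(r-1)) for r ≥ 1 (nonnegative for x ≥ 1)
F : ℕ → ℕ → ℕ
F zero x = x ∸ 1
F (suc r) x = x ^ (2 ^ suc r) ∸ x ^ (2 ^ r)

-- the rational p / q  (convention: 0 when q = 0; only used with q ≥ 1)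
ratio : ℕ → ℕ → ℚ
ratio p zero = 0ℚ
ratio p (suc q) = + p / suc q

sumQ : ∀ {n} → (Fin n → ℚ) → ℚ
sumQ {zero} f = 0ℚ
sumQ {suc n} f = f fzero + sumQ (λ j → f (fsuc j))

prodQ : ∀ {n} → (Fin n → ℚ) → ℚ
prodQ {zero} f = 1ℚ
prodQ {suc n} f = f fzero * prodQ (λ j → f (fsuc j))

prodℕ : ∀ {n} → (Fin n → ℕ) → ℕ
prodℕ {zero} f = 1
prodℕ {suc n} f = f fzero ℕ.* prodℕ (λ j → f (fsuc j))

-- Index j : Fin R stands for j+1 ∈ {1,…,R}.  The decomposition
-- {1,…,R} = J_1 ∪ … ∪ J_k (pairwise disjoint) is given by c : Fin R → Fin k,
-- with J_i = { j | c j = i }.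
-- partProd R k m c i N = ∏_{1 ≤ j ≤ N, j ∈ J_i} (1 - 1/m_j)
partProd : (R k : ℕ) → (Fin R → ℕ) → (Fin R → Fin k) → Fin k → ℕ → ℚ
partProd R k m c i N =
  prodQ (λ j → if ⌊ c j ≟ᶠ i ⌋ ∧ (toℕ j <ᵇ N)
               then 1ℚ - ratio 1 (m j)
               else 1ℚ)

weightedSum : (R k : ℕ) → (Fin R → ℕ) → (Fin R → Fin k) →
              (Fin k → ℕ) → (Fin k → ℕ) → ℕ → ℚ
weightedSum R k m c a b N = sumQ (λ i → ratio (b i) (a i) * partProd R k m c i N)

module Submission where

-- Let a = a₁⋯a_k and S(N) = Σᵢ (bᵢ/aᵢ) ∏_{j ≤ N, j ∈ Jᵢ} (1 - 1/mⱼ).  The proof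
-- has two halves.
--
-- Adding index j to the products lowers
-- S by at most 1/mⱼ, so S(N) ≤ S(R) + Σ_{j > N} 1/mⱼ ≤ 1 + Σ_{j > N} 1/mⱼ;
-- and S(N) is a fraction with denominator a m₁⋯m_N, so S(N) > 1 forces
-- S(N) ≥ 1 + 1/(a m₁⋯m_N).  For N < R both apply (S(N) ≥ S(R-1) > 1), giving
-- the tail condition  1/(a m₁⋯m_N) ≤ Σ_{j > N} 1/mⱼ.
--
-- For a nondecreasing sequence
-- of positive integers satisfying the tail condition started at G, the product
-- G x₁⋯x_R is maximal for the Sylvester sequence, i.e. at most G_{R-1}² with
-- G₀ = G and G_{i+1} = G_i(G_i + 1).  The comparison with the Sylvester
-- sequence goes through a sum-domination lemma (module SumDomination), and
-- G_{R-1}² ≤ F_R(G + 1) (module GreedyVersusF).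

open import Defs
open import Data.Nat as ℕ using (ℕ; zero; suc; z≤n; s≤s)
import Data.Nat.Properties as ℕP
open import Data.Nat.Tactic.RingSolver using (solve-∀)
open import Data.Rational as ℚ using (ℚ; 0ℚ; 1ℚ)
import Data.Rational.Properties as ℚP
open import Data.Fin using (Fin; toℕ) renaming (zero to fzero; suc to fsuc)
open import Data.Product using (_×_; _,_; proj₁; proj₂)
open import Relation.Binary.PropositionalEquality

1≤-* : ∀ {a b} → 1 ℕ.≤ a → 1 ℕ.≤ b → 1 ℕ.≤ a ℕ.* b
1≤-* {suc a} {suc b} _ _ = s≤s z≤n

-- The proofs pass through unnormalised rationals,
-- where `ratio p (1 + q)` is literally the pair (p , q).
module Fractions where

  open import Data.Integer as ℤ using (+_)
  import Data.Integer.Properties as ℤP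
  open import Data.Rational using (_+_; _*_; _≤_; _<_; toℚᵘ)
  import Data.Rational.Unnormalised as U
  import Data.Rational.Unnormalised.Properties as UP

  private
    toℚᵘ-ratio : ∀ p q → toℚᵘ (ratio p (suc q)) U.≃ U.mkℚᵘ (+ p) q
    toℚᵘ-ratio p q = ℚP.toℚᵘ-fromℚᵘ (U.mkℚᵘ (+ p) q)

    cross : ∀ p s → + p ℤ.* + s ≡ + (p ℕ.* s)
    cross p s = sym (ℤP.pos-* p s)

  ratio-cong : ∀ p q r s → 1 ℕ.≤ q → 1 ℕ.≤ s →
               p ℕ.* s ≡ r ℕ.* q → ratio p q ≡ ratio r s
  ratio-cong p (suc q) r (suc s) _ _ e = ℚP.toℚᵘ-injective
    (UP.≃-trans (toℚᵘ-ratio p q)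
    (UP.≃-trans (U.*≡* (trans (cross p (suc s)) (trans (cong +_ e) (sym (cross r (suc q))))))
                (UP.≃-sym (toℚᵘ-ratio r s))))

  ratio-mono-≤ : ∀ p q r s → 1 ℕ.≤ q → 1 ℕ.≤ s →
                 p ℕ.* s ℕ.≤ r ℕ.* q → ratio p q ≤ ratio r s
  ratio-mono-≤ p (suc q) r (suc s) _ _ le = ℚP.toℚᵘ-cancel-≤
    (UP.≤-respˡ-≃ (UP.≃-sym (toℚᵘ-ratio p q)) (UP.≤-respʳ-≃ (UP.≃-sym (toℚᵘ-ratio r s))
      (U.*≤* (subst₂ ℤ._≤_ (sym (cross p (suc s))) (sym (cross r (suc q))) (ℤ.+≤+ le)))))

  ratio-mono-< : ∀ p q r s → 1 ℕ.≤ q → 1 ℕ.≤ s →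
                 p ℕ.* s ℕ.< r ℕ.* q → ratio p q < ratio r s
  ratio-mono-< p (suc q) r (suc s) _ _ lt = ℚP.toℚᵘ-cancel-<
    (UP.<-respˡ-≃ (UP.≃-sym (toℚᵘ-ratio p q)) (UP.<-respʳ-≃ (UP.≃-sym (toℚᵘ-ratio r s))
      (U.*<* (subst₂ ℤ._<_ (sym (cross p (suc s))) (sym (cross r (suc q))) (ℤ.+<+ lt)))))

  ratio-cancel-< : ∀ p q r s → 1 ℕ.≤ q → 1 ℕ.≤ s →
                   ratio p q < ratio r s → p ℕ.* s ℕ.< r ℕ.* q
  ratio-cancel-< p (suc q) r (suc s) _ _ lt
    with UP.<-respˡ-≃ (toℚᵘ-ratio p q) (UP.<-respʳ-≃ (toℚᵘ-ratio r s) (ℚP.toℚᵘ-mono-< lt))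
  ... | U.*<* lt′ = ℤP.drop‿+<+ (subst₂ ℤ._<_ (cross p (suc s)) (cross r (suc q)) lt′)

  ratio-+ : ∀ p q r s → 1 ℕ.≤ q → 1 ℕ.≤ s →
            ratio p q + ratio r s ≡ ratio (p ℕ.* s ℕ.+ r ℕ.* q) (q ℕ.* s)
  ratio-+ p (suc q) r (suc s) _ _ = ℚP.toℚᵘ-injective
    (UP.≃-trans (ℚP.toℚᵘ-homo-+ (ratio p (suc q)) (ratio r (suc s)))
    (UP.≃-trans (UP.+-cong (toℚᵘ-ratio p q) (toℚᵘ-ratio r s))
    (UP.≃-trans (UP.≃-reflexive (cong (λ n → U.mkℚᵘ n (s ℕ.+ q ℕ.* suc s)) numerator))
                (UP.≃-sym (toℚᵘ-ratio _ _)))))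
    where
    numerator : + p ℤ.* + suc s ℤ.+ + r ℤ.* + suc q ≡ + (p ℕ.* suc s ℕ.+ r ℕ.* suc q)
    numerator = trans (cong₂ ℤ._+_ (cross p (suc s)) (cross r (suc q)))
                      (sym (ℤP.pos-+ (p ℕ.* suc s) (r ℕ.* suc q)))

  ratio-* : ∀ p q r s → 1 ℕ.≤ q → 1 ℕ.≤ s →
            ratio p q * ratio r s ≡ ratio (p ℕ.* r) (q ℕ.* s)
  ratio-* p (suc q) r (suc s) _ _ = ℚP.toℚᵘ-injective
    (UP.≃-trans (ℚP.toℚᵘ-homo-* (ratio p (suc q)) (ratio r (suc s)))
    (UP.≃-trans (UP.*-cong (toℚᵘ-ratio p q) (toℚᵘ-ratio r s))
    (UP.≃-trans (UP.≃-reflexive (cong (λ n → U.mkℚᵘ n (s ℕ.+ q ℕ.* suc s)) (cross p r)))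
                (UP.≃-sym (toℚᵘ-ratio _ _)))))

  ratio-self : ∀ n → 1 ℕ.≤ n → ratio n n ≡ 1ℚ
  ratio-self n n≥1 = ratio-cong n n 1 1 n≥1 (s≤s z≤n) (trans (ℕP.*-identityʳ n) (sym (ℕP.*-identityˡ n)))

  ratio-+-same : ∀ p r d → 1 ℕ.≤ d → ratio p d + ratio r d ≡ ratio (p ℕ.+ r) d
  ratio-+-same p r d d≥1 = trans (ratio-+ p d r d d≥1 d≥1)
    (ratio-cong _ _ _ _ (1≤-* d≥1 d≥1) d≥1 (e p r d))
    where
    e : ∀ p r d → (p ℕ.* d ℕ.+ r ℕ.* d) ℕ.* d ≡ (p ℕ.+ r) ℕ.* (d ℕ.* d)
    e = solve-∀

module Reciprocals where

  open Fractions
  open import Data.Rational using (_+_; _*_; _-_; -_; _≤_)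
  open import Data.Rational.Solver
  open +-*-Solver using (solve; _:+_; _:-_; _:=_)
  open import Data.Nat using (_∸_)

  *-monoˡ-≤ : ∀ c {p q} → 0ℚ ≤ c → p ≤ q → c * p ≤ c * q
  *-monoˡ-≤ c c≥0 = ℚP.*-monoˡ-≤-nonNeg c {{ℚ.nonNegative c≥0}}

  *-monoʳ-≤ : ∀ c {p q} → 0ℚ ≤ c → p ≤ q → p * c ≤ q * c
  *-monoʳ-≤ c c≥0 = ℚP.*-monoʳ-≤-nonNeg c {{ℚ.nonNegative c≥0}}

  *-nonNeg : ∀ {p q} → 0ℚ ≤ p → 0ℚ ≤ q → 0ℚ ≤ p * q
  *-nonNeg {p} p≥0 q≥0 = subst (_≤ p * _) (ℚP.*-zeroʳ p) (*-monoˡ-≤ p p≥0 q≥0)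

  ≤⇒0≤- : ∀ {p q} → p ≤ q → 0ℚ ≤ q - p
  ≤⇒0≤- {p} {q} p≤q = subst (_≤ q - p) (ℚP.+-inverseʳ p) (ℚP.+-monoˡ-≤ (- p) p≤q)

  0≤-⇒≤ : ∀ {p q} → 0ℚ ≤ q - p → p ≤ q
  0≤-⇒≤ {p} {q} h = subst₂ _≤_ (ℚP.+-identityˡ p) (e q p) (ℚP.+-monoˡ-≤ p h)
    where
    e : ∀ q p → q - p + p ≡ q
    e = solve 2 (λ q p → q :- p :+ p := q) refl

  0≤1 : 0ℚ ≤ 1ℚ
  0≤1 = ℚP.<⇒≤ (ℚP.positive⁻¹ 1ℚ)

  recip : ℕ → ℚ
  recip n = ratio 1 n

  nat : ℕ → ℚ
  nat n = ratio n 1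

  recip-nonNeg : ∀ n → 0ℚ ≤ recip n
  recip-nonNeg zero = ℚP.≤-refl
  recip-nonNeg (suc n) = ratio-mono-≤ 0 1 1 (suc n) (s≤s z≤n) (s≤s z≤n) z≤n

  recip-antitone : ∀ {x y} → 1 ℕ.≤ x → x ℕ.≤ y → recip y ≤ recip x
  recip-antitone {x} {y} x≥1 x≤y = ratio-mono-≤ 1 y 1 x (ℕP.≤-trans x≥1 x≤y) x≥1
    (subst₂ ℕ._≤_ (sym (ℕP.*-identityˡ x)) (sym (ℕP.*-identityˡ y)) x≤y)

  nat-nonNeg : ∀ n → 0ℚ ≤ nat n
  nat-nonNeg n = ratio-mono-≤ 0 1 n 1 (s≤s z≤n) (s≤s z≤n) z≤n

  nat*recip : ∀ x → 1 ℕ.≤ x → nat x * recip x ≡ 1ℚ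
  nat*recip x x≥1 = trans (ratio-* x 1 1 x (s≤s z≤n) x≥1)
    (ratio-cong (x ℕ.* 1) (1 ℕ.* x) 1 1 (1≤-* {1} {x} (s≤s z≤n) x≥1) (s≤s z≤n) (e x))
    where
    e : ∀ x → x ℕ.* 1 ℕ.* 1 ≡ 1 ℕ.* (1 ℕ.* x)
    e = solve-∀

  ratio-*-recip : ∀ p q x → 1 ℕ.≤ q → 1 ℕ.≤ x → ratio p q * recip x ≡ ratio p (q ℕ.* x)
  ratio-*-recip p q x q≥1 x≥1 =
    trans (ratio-* p q 1 x q≥1 x≥1) (cong (λ n → ratio n (q ℕ.* x)) (ℕP.*-identityʳ p))

  1-recip : ∀ M → 1 ℕ.≤ M → 1ℚ - recip M ≡ ratio (M ∸ 1) M
  1-recip (suc M) M≥1 =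
    trans (cong (_- recip (suc M)) (sym sum≡1)) (cancel (ratio M (suc M)) (recip (suc M)))
    where
    sum≡1 : ratio M (suc M) + recip (suc M) ≡ 1ℚ
    sum≡1 = trans (ratio-+-same M 1 (suc M) M≥1)
              (ratio-cong (M ℕ.+ 1) (suc M) 1 1 M≥1 (s≤s z≤n)
                (trans (ℕP.*-identityʳ _) (trans (ℕP.+-comm M 1) (sym (ℕP.*-identityˡ _)))))
    cancel : ∀ x r → x + r - r ≡ x
    cancel = solve 2 (λ x r → x :+ r :- r := x) refl

-- Induction on the length: the excess
-- h₁ - 1/x₁ of the first term is absorbed into the first later term hⱼ ≤ 1/x₁
-- (multiplying it by x₁h₁ ≥ 1); this keeps the product hypothesis for the tail
-- and raises the tail sum by at most the excess.
module SumDomination where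

  open Reciprocals
  open import Data.Rational using (_+_; _*_; _-_; _≤_)
  open import Data.Rational.Solver
  open +-*-Solver using (solve; _:+_; _:*_; _:-_; _:=_; con)
  open import Data.List using (List; []; _∷_; map)
  open import Data.List.Relation.Unary.All using (All; []; _∷_)
  open import Data.List.Relation.Unary.AllPairs using (AllPairs; []; _∷_)
  open import Data.Unit using (⊤; tt)
  open import Data.Empty using (⊥)
  open import Relation.Nullary using (yes; no)

  sumℚ : List ℚ → ℚ
  sumℚ [] = 0ℚ
  sumℚ (h ∷ hs) = h + sumℚ hs

  -- `Dominated α β xs hs`: the lists have equal length and for every t ≥ 1
  -- α · ∏_{i ≤ t} 1/xᵢ  ≤  β · ∏_{i ≤ t} hᵢ.
  Dominated : ℚ → ℚ → List ℕ → List ℚ → Set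
  Dominated α β [] [] = ⊤
  Dominated α β (x ∷ xs) (h ∷ hs) =
    α * recip x ≤ β * h × Dominated (α * recip x) (β * h) xs hs
  Dominated α β _ _ = ⊥

  Dominated-scale : ∀ c {α β} xs hs → 0ℚ ≤ c →
                    Dominated α β xs hs → Dominated (c * α) (c * β) xs hs
  Dominated-scale c [] [] _ _ = tt
  Dominated-scale c {α} {β} (x ∷ xs) (h ∷ hs) c≥0 (le , d)
    rewrite ℚP.*-assoc c α (recip x) | ℚP.*-assoc c β h =
    *-monoˡ-≤ c c≥0 le , Dominated-scale c xs hs c≥0 d

  absorb : ℚ → ℕ → List ℚ → List ℚ
  absorb h x [] = []
  absorb h x (k ∷ ks) with k ℚP.≤? recip x
  ... | yes _ = k * h * nat x ∷ ks
  ... | no _ = k ∷ absorb h x ks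

  absorb-dominated : ∀ {A B h x} ys hs → 1 ℕ.≤ x → 0ℚ ≤ A → A ≤ B → All (x ℕ.≤_) ys →
                     Dominated (A * recip x) (B * h) ys hs → Dominated A B ys (absorb h x hs)
  absorb-dominated [] [] _ _ _ _ _ = tt
  absorb-dominated {A} {B} {h} {x} (y ∷ ys) (k ∷ ks) x≥1 A≥0 A≤B (x≤y ∷ x≤ys) (hd , d)
    with k ℚP.≤? recip x
  ... | yes _ = subst₂ _≤_ eA eB (*-monoˡ-≤ (nat x) (nat-nonNeg x) hd) ,
                subst₂ (λ α β → Dominated α β ys ks) eA eB (Dominated-scale (nat x) ys ks (nat-nonNeg x) d)
    where
    eA : nat x * (A * recip x * recip y) ≡ A * recip y
    eA = trans (solve 4 (λ X A z w → X :* (A :* z :* w) := A :* w :* (X :* z)) refl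
                   (nat x) A (recip x) (recip y))
                 (trans (cong (A * recip y *_) (nat*recip x x≥1)) (ℚP.*-identityʳ _))
    eB : nat x * (B * h * k) ≡ B * (k * h * nat x)
    eB = solve 4 (λ X B h k → X :* (B :* h :* k) := B :* (k :* h :* X)) refl (nat x) B h k
  ... | no k≰1/x =
    head-le ,
    absorb-dominated ys ks x≥1 (*-nonNeg A≥0 (recip-nonNeg y)) head-le x≤ys
      (subst₂ (λ α β → Dominated α β ys ks) (swap A (recip x) (recip y)) (swap B h k) d)
    where
    head-le : A * recip y ≤ B * k
    head-le = ℚP.≤-trans (*-monoˡ-≤ A A≥0 (recip-antitone x≥1 x≤y))
              (ℚP.≤-trans (*-monoʳ-≤ (recip x) (recip-nonNeg x) A≤B)
                          (*-monoˡ-≤ B (ℚP.≤-trans A≥0 A≤B) (ℚP.<⇒≤ (ℚP.≰⇒> k≰1/x))))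
    swap : ∀ a b c → a * b * c ≡ a * c * b
    swap = solve 3 (λ a b c → a :* b :* c := a :* c :* b) refl
  absorb-dominated [] (_ ∷ _) _ _ _ _ ()
  absorb-dominated (_ ∷ _) [] _ _ _ _ ()

  absorb-sum : ∀ {h x} hs → 1 ℕ.≤ x → recip x ≤ h →
               sumℚ (absorb h x hs) ≤ sumℚ hs + (h - recip x)
  absorb-sum {h} {x} [] _ 1/x≤h = subst (_≤ 0ℚ + (h - recip x)) (ℚP.+-identityˡ 0ℚ)
                                    (ℚP.+-monoʳ-≤ 0ℚ (≤⇒0≤- 1/x≤h))
  absorb-sum {h} {x} (k ∷ ks) x≥1 1/x≤h with k ℚP.≤? recip x
  ... | yes k≤1/x = subst (k * h * nat x + sumℚ ks ≤_) (reassoc k (h - recip x) (sumℚ ks))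
                      (ℚP.+-monoˡ-≤ (sumℚ ks) absorbed≤)
    where
    X = nat x
    z = recip x
    gap : k + (h - z) - k * h * X ≡ X * (h - z) * (z - k)
    gap = begin
      k + (h - z) - k * h * X
        ≡⟨ expand k h z X ⟩
      X * (h - z) * (z - k) + (1ℚ - X * z) * (k + h - z)
        ≡⟨ cong (λ t → X * (h - z) * (z - k) + (1ℚ - t) * (k + h - z)) (nat*recip x x≥1) ⟩
      X * (h - z) * (z - k) + (1ℚ - 1ℚ) * (k + h - z)
        ≡⟨ drop X h z k ⟩
      X * (h - z) * (z - k) ∎
      where
      open ≡-Reasoning
      expand : ∀ k h z X → k + (h - z) - k * h * X ≡ X * (h - z) * (z - k) + (1ℚ - X * z) * (k + h - z)
      expand = solve 4 (λ k h z X → k :+ (h :- z) :- k :* h :* X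
                          := X :* (h :- z) :* (z :- k) :+ (con 1ℚ :- X :* z) :* (k :+ h :- z)) refl
      drop : ∀ X h z k → X * (h - z) * (z - k) + (1ℚ - 1ℚ) * (k + h - z) ≡ X * (h - z) * (z - k)
      drop = solve 4 (λ X h z k → X :* (h :- z) :* (z :- k) :+ (con 1ℚ :- con 1ℚ) :* (k :+ h :- z)
                        := X :* (h :- z) :* (z :- k)) refl
    absorbed≤ : k * h * X ≤ k + (h - recip x)
    absorbed≤ = 0≤-⇒≤ (subst (0ℚ ≤_) (sym gap)
                  (*-nonNeg (*-nonNeg (nat-nonNeg x) (≤⇒0≤- 1/x≤h)) (≤⇒0≤- k≤1/x)))
    reassoc : ∀ k e s → k + e + s ≡ k + s + e
    reassoc = solve 3 (λ k e s → k :+ e :+ s := k :+ s :+ e) refl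
  ... | no _ = subst (k + sumℚ (absorb h x ks) ≤_) (sym (ℚP.+-assoc k (sumℚ ks) (h - recip x)))
                 (ℚP.+-monoʳ-≤ k (absorb-sum ks x≥1 1/x≤h))

  sum-dominated : ∀ xs hs → AllPairs ℕ._≤_ xs → All (1 ℕ.≤_) xs → Dominated 1ℚ 1ℚ xs hs →
                  sumℚ (map recip xs) ≤ sumℚ hs
  sum-dominated [] [] _ _ _ = ℚP.≤-refl
  sum-dominated (x ∷ xs) (h ∷ hs) (x≤xs ∷ sorted) (x≥1 ∷ pos) (hd , d) =
    ℚP.≤-trans (ℚP.+-monoʳ-≤ (recip x) tail≤)
    (subst (recip x + sumℚ (absorb h x hs) ≤_) (regroup (recip x) (sumℚ hs) h)
           (ℚP.+-monoʳ-≤ (recip x) (absorb-sum hs x≥1 1/x≤h)))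
    where
    1/x≤h : recip x ≤ h
    1/x≤h = subst₂ _≤_ (ℚP.*-identityˡ _) (ℚP.*-identityˡ _) hd
    tail≤ : sumℚ (map recip xs) ≤ sumℚ (absorb h x hs)
    tail≤ = sum-dominated xs (absorb h x hs) sorted pos
              (absorb-dominated xs hs x≥1 0≤1 ℚP.≤-refl x≤xs d)
    regroup : ∀ z s h → z + (s + (h - z)) ≡ h + s
    regroup = solve 3 (λ z s h → z :+ (s :+ (h :- z)) := h :+ s) refl
  sum-dominated [] (_ ∷ _) _ _ ()
  sum-dominated (_ ∷ _) [] _ _ ()

-- Let G ≥ 1 and let x₁ ≤ … ≤ xₙ be positive
-- naturals with 1/(G x₁⋯x_t) ≤ Σ_{i>t} 1/xᵢ for every t < n.  Then G x₁⋯xₙ is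
-- at most G_{n-1}², where G₀ = G and G_{i+1} = G_i(G_i + 1); the extremal
-- choice is the greedy (Sylvester) sequence xᵢ = G_{i-1} + 1.  The proof shows
-- by induction along the list that, if the product exceeded this bound, the
-- Sylvester iterates of Y would stay below the partial products of P; the
-- first of these inequalities for P = Y = G is absurd.  Each inequality comes
-- from comparing the xᵢ with the greedy sequence through sum domination.
module ExtremalProduct where

  open Fractions
  open Reciprocals
  open SumDomination
  open import Data.Rational using (_+_; _*_; _≤_; _<_)
  open import Data.List using (List; []; _∷_; map; length)
  open import Data.Nat.ListAction using (product)
  open import Data.List.Relation.Unary.All using (All; []; _∷_)
  open import Data.List.Relation.Unary.AllPairs using (AllPairs; []; _∷_)
  open import Data.Unit using (⊤; tt)
  open import Data.Empty using (⊥-elim)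
  open import Relation.Nullary using (yes; no)

  -- The extremal value of G·x₁⋯xₙ: G for n = 0 and G_{n-1}² otherwise.
  greedyBound : ℕ → ℕ → ℕ
  greedyBound G zero = G
  greedyBound G (suc zero) = G ℕ.* G
  greedyBound G (suc (suc n)) = greedyBound (G ℕ.* suc G) (suc n)

  greedy : ℕ → ℕ → ℕ → List ℚ
  greedy G zero T = []
  greedy G (suc zero) T = ratio G T ∷ []
  greedy G (suc (suc n)) T = recip (suc G) ∷ greedy (G ℕ.* suc G) (suc n) T

  recip-split : ∀ g → recip (suc (suc g)) + recip (suc g ℕ.* suc (suc g)) ≡ recip (suc g)
  recip-split g = trans (ratio-+ 1 (suc (suc g)) 1 (suc g ℕ.* suc (suc g)) (s≤s z≤n) (s≤s z≤n))
    (ratio-cong (1 ℕ.* (suc g ℕ.* suc (suc g)) ℕ.+ 1 ℕ.* suc (suc g))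
                (suc (suc g) ℕ.* (suc g ℕ.* suc (suc g))) 1 (suc g) (s≤s z≤n) (s≤s z≤n) (e g))
    where
    e : ∀ g → (1 ℕ.* (suc g ℕ.* suc (suc g)) ℕ.+ 1 ℕ.* suc (suc g)) ℕ.* suc g
              ≡ 1 ℕ.* (suc (suc g) ℕ.* (suc g ℕ.* suc (suc g)))
    e = solve-∀

  -- The sum of the greedy list of length n + 1 telescopes to
  -- 1/G - 1/G_n + G_n/T, which is below 1/G as soon as G_n² < T.
  greedy-sum : ∀ G n T → 1 ℕ.≤ G → greedyBound G (suc n) ℕ.< T →
               sumℚ (greedy G (suc n) T) < recip G
  greedy-sum (suc g) zero T _ lt =
    subst (_< recip (suc g)) (sym (ℚP.+-identityʳ _))
      (ratio-mono-< (suc g) T 1 (suc g) (ℕP.≤-trans (s≤s z≤n) lt) (s≤s z≤n)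
        (subst (suc g ℕ.* suc g ℕ.<_) (sym (ℕP.*-identityˡ T)) lt))
  greedy-sum (suc g) (suc n) T _ lt =
    subst (recip (suc (suc g)) + sumℚ (greedy (suc g ℕ.* suc (suc g)) (suc n) T) <_) (recip-split g)
      (ℚP.+-monoʳ-< (recip (suc (suc g))) (greedy-sum (suc g ℕ.* suc (suc g)) n T (s≤s z≤n) lt))

  Chain : ℕ → ℕ → List ℕ → Set
  Chain P Y [] = ⊤
  Chain P Y (x ∷ xs) = Y ℕ.< P × Chain (P ℕ.* x) (Y ℕ.* suc Y) xs

  greedy-dominates : ∀ P₀ Y₀ P G T x xs → P₀ ℕ.≤ Y₀ → 1 ℕ.≤ P → 1 ℕ.≤ G →
                     All (1 ℕ.≤_) (x ∷ xs) → Chain (P ℕ.* x) (G ℕ.* suc G) xs →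
                     T ≡ P ℕ.* product (x ∷ xs) →
                     Dominated (ratio P₀ P) (ratio Y₀ G) (x ∷ xs) (greedy G (length (x ∷ xs)) T)
  greedy-dominates P₀ Y₀ P G T x [] P₀≤Y₀ P≥1 G≥1 (x≥1 ∷ []) _ T≡ =
    subst₂ _≤_ (sym lhs) (sym rhs)
      (ratio-mono-≤ P₀ T Y₀ T T≥1 T≥1 (ℕP.*-monoˡ-≤ T P₀≤Y₀)) , tt
    where
    T≥1 : 1 ℕ.≤ T
    T≥1 = subst (1 ℕ.≤_) (sym T≡) (1≤-* P≥1 (1≤-* x≥1 (s≤s z≤n)))
    lhs : ratio P₀ P * recip x ≡ ratio P₀ T
    lhs = trans (ratio-*-recip P₀ P x P≥1 x≥1)
                (cong (ratio P₀) (trans (cong (P ℕ.*_) (sym (ℕP.*-identityʳ x))) (sym T≡)))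
    rhs : ratio Y₀ G * ratio G T ≡ ratio Y₀ T
    rhs = trans (ratio-* Y₀ G G T G≥1 T≥1)
                (ratio-cong (Y₀ ℕ.* G) (G ℕ.* T) Y₀ T (1≤-* G≥1 T≥1) T≥1 (e Y₀ G T))
      where
      e : ∀ Y G T → Y ℕ.* G ℕ.* T ≡ Y ℕ.* (G ℕ.* T)
      e = solve-∀
  greedy-dominates P₀ Y₀ P G T x (x′ ∷ xs) P₀≤Y₀ P≥1 G≥1 (x≥1 ∷ pos) (G₁<Px , chain) T≡ =
    subst₂ _≤_ (sym lhs) (sym rhs) head-le ,
    subst₂ (λ α β → Dominated α β (x′ ∷ xs) (greedy (G ℕ.* suc G) (length (x′ ∷ xs)) T))
      (sym lhs) (sym rhs)
      (greedy-dominates P₀ Y₀ (P ℕ.* x) (G ℕ.* suc G) T x′ xs P₀≤Y₀ (1≤-* P≥1 x≥1)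
        (1≤-* G≥1 (s≤s z≤n)) pos chain (trans T≡ (sym (ℕP.*-assoc P x _))))
    where
    lhs : ratio P₀ P * recip x ≡ ratio P₀ (P ℕ.* x)
    lhs = ratio-*-recip P₀ P x P≥1 x≥1
    rhs : ratio Y₀ G * recip (suc G) ≡ ratio Y₀ (G ℕ.* suc G)
    rhs = ratio-*-recip Y₀ G (suc G) G≥1 (s≤s z≤n)
    head-le : ratio P₀ (P ℕ.* x) ≤ ratio Y₀ (G ℕ.* suc G)
    head-le = ratio-mono-≤ P₀ (P ℕ.* x) Y₀ (G ℕ.* suc G) (1≤-* P≥1 x≥1) (1≤-* G≥1 (s≤s z≤n))
                (ℕP.*-mono-≤ P₀≤Y₀ (ℕP.<⇒≤ G₁<Px))

  TailCondition : ℕ → List ℕ → Set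
  TailCondition P [] = ⊤
  TailCondition P (x ∷ xs) =
    recip P ≤ sumℚ (map recip (x ∷ xs)) × TailCondition (P ℕ.* x) xs

  -- The first link of a chain: given the tail of the chain, Y ≥ P would make
  -- Σ 1/xᵢ ≤ Σ greedy < 1/Y ≤ 1/P, against the tail condition at t = 0.
  chain-head : ∀ P Y x xs → 1 ℕ.≤ P → 1 ℕ.≤ Y →
               recip P ≤ sumℚ (map recip (x ∷ xs)) →
               AllPairs ℕ._≤_ (x ∷ xs) → All (1 ℕ.≤_) (x ∷ xs) →
               Chain (P ℕ.* x) (Y ℕ.* suc Y) xs →
               greedyBound Y (length (x ∷ xs)) ℕ.< P ℕ.* product (x ∷ xs) → Y ℕ.< P
  chain-head P Y x xs P≥1 Y≥1 cond sorted pos chain big with Y ℕP.<? P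
  ... | yes Y<P = Y<P
  ... | no Y≮P = ⊥-elim (ℕP.<⇒≱ Y<P (ℕP.≮⇒≥ Y≮P))
    where
    T = P ℕ.* product (x ∷ xs)
    dominated : Dominated 1ℚ 1ℚ (x ∷ xs) (greedy Y (length (x ∷ xs)) T)
    dominated = subst₂ (λ α β → Dominated α β (x ∷ xs) (greedy Y (length (x ∷ xs)) T))
                  (ratio-self P P≥1) (ratio-self Y Y≥1)
                  (greedy-dominates P Y P Y T x xs (ℕP.≮⇒≥ Y≮P) P≥1 Y≥1 pos chain refl)
    1/P<1/Y : recip P < recip Y
    1/P<1/Y = ℚP.≤-<-trans cond (ℚP.≤-<-trans (sum-dominated (x ∷ xs) _ sorted pos dominated)
                                              (greedy-sum Y (length xs) T Y≥1 big))
    Y<P : Y ℕ.< P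
    Y<P = subst₂ ℕ._<_ (ℕP.*-identityˡ Y) (ℕP.*-identityˡ P)
            (ratio-cancel-< 1 P 1 Y P≥1 Y≥1 1/P<1/Y)

  chain : ∀ P Y xs → 1 ℕ.≤ P → 1 ℕ.≤ Y →
          TailCondition P xs → AllPairs ℕ._≤_ xs → All (1 ℕ.≤_) xs →
          greedyBound Y (length xs) ℕ.< P ℕ.* product xs → Chain P Y xs
  chain P Y [] _ _ _ _ _ _ = tt
  chain P Y (x ∷ []) P≥1 Y≥1 (cond , _) sorted pos big =
    chain-head P Y x [] P≥1 Y≥1 cond sorted pos tt big , tt
  chain P Y (x ∷ xs@(_ ∷ _)) P≥1 Y≥1 (cond , conds) sorted@(_ ∷ sorted′) pos@(x≥1 ∷ pos′) big =
    chain-head P Y x xs P≥1 Y≥1 cond sorted pos rest big , rest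
    where
    rest : Chain (P ℕ.* x) (Y ℕ.* suc Y) xs
    rest = chain (P ℕ.* x) (Y ℕ.* suc Y) xs (1≤-* P≥1 x≥1) (1≤-* Y≥1 (s≤s z≤n)) conds sorted′ pos′
             (subst (greedyBound Y (length (x ∷ xs)) ℕ.<_) (sym (ℕP.*-assoc P x _)) big)

  -- The extremal product bound itself: otherwise the chain for P = Y = G
  -- would start with G < G.
  extremal-product : ∀ G xs → 1 ℕ.≤ G →
                     TailCondition G xs → AllPairs ℕ._≤_ xs → All (1 ℕ.≤_) xs →
                     G ℕ.* product xs ℕ.≤ greedyBound G (length xs)
  extremal-product G [] _ _ _ _ = ℕP.≤-reflexive (ℕP.*-identityʳ G)
  extremal-product G (x ∷ xs) G≥1 cond sorted pos
    with G ℕ.* product (x ∷ xs) ℕP.≤? greedyBound G (length (x ∷ xs))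
  ... | yes bounded = bounded
  ... | no unbounded =
    ⊥-elim (ℕP.<-irrefl refl
             (proj₁ (chain G G (x ∷ xs) G≥1 G≥1 cond sorted pos (ℕP.≰⇒> unbounded))))

-- For r = 0 this is
-- G² ≤ (G+1)G; the step uses that F_{r+1} is monotone and
-- F_{r+1}(x²) = F_{r+2}(x), so that
-- greedyBound G (r+2) = greedyBound (G(G+1)) (r+1) ≤ F_{r+1}(G(G+1) + 1)
--                     ≤ F_{r+1}((G+1)²) = F_{r+2}(G+1).
module GreedyVersusF where

  open ExtremalProduct using (greedyBound)
  open import Data.Nat using (_^_; _∸_)

  pow-double : ∀ x k → x ^ (2 ^ suc k) ≡ x ^ (2 ^ k) ℕ.* x ^ (2 ^ k)
  pow-double x k = trans (ℕP.^-distribˡ-+-* x (2 ^ k) (2 ^ k ℕ.+ 0))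
                         (cong (λ t → x ^ (2 ^ k) ℕ.* x ^ t) (ℕP.+-identityʳ (2 ^ k)))

  square-pow : ∀ x k → (x ℕ.* x) ^ (2 ^ k) ≡ x ^ (2 ^ suc k)
  square-pow x k = trans (cong (λ y → (x ℕ.* y) ^ (2 ^ k)) (sym (ℕP.*-identityʳ x)))
                         (ℕP.^-*-assoc x 2 (2 ^ k))

  F-factor : ∀ r y → F (suc r) y ≡ y ^ (2 ^ r) ℕ.* (y ^ (2 ^ r) ∸ 1)
  F-factor r y = trans (cong (_∸ u) (pow-double y r))
    (trans (cong (u ℕ.* u ∸_) (sym (ℕP.*-identityʳ u))) (sym (ℕP.*-distribˡ-∸ u u 1)))
    where
    u = y ^ (2 ^ r)

  F-mono : ∀ r {y y′} → y ℕ.≤ y′ → F (suc r) y ℕ.≤ F (suc r) y′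
  F-mono r {y} {y′} y≤y′ = subst₂ ℕ._≤_ (sym (F-factor r y)) (sym (F-factor r y′))
    (ℕP.*-mono-≤ u≤u′ (ℕP.∸-monoˡ-≤ 1 u≤u′))
    where
    u≤u′ : y ^ (2 ^ r) ℕ.≤ y′ ^ (2 ^ r)
    u≤u′ = ℕP.^-monoˡ-≤ (2 ^ r) y≤y′

  F-square : ∀ r x → F (suc r) (x ℕ.* x) ≡ F (suc (suc r)) x
  F-square r x = cong₂ _∸_ (square-pow x (suc r)) (square-pow x r)

  greedyBound≤F : ∀ r G → greedyBound G (suc r) ℕ.≤ F (suc r) (suc G)
  greedyBound≤F zero G = subst (G ℕ.* G ℕ.≤_) (sym (F-factor 0 (suc G)))
    (subst (λ t → G ℕ.* G ℕ.≤ t ℕ.* (t ∸ 1)) (sym (ℕP.*-identityʳ (suc G)))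
      (ℕP.*-monoˡ-≤ G (ℕP.n≤1+n G)))
  greedyBound≤F (suc r) G = ℕP.≤-trans (greedyBound≤F r (G ℕ.* suc G))
    (subst (F (suc r) (suc (G ℕ.* suc G)) ℕ.≤_) (F-square r (suc G))
      (F-mono r (s≤s (ℕP.m≤n+m (G ℕ.* suc G) G))))

module FinSums where

  open Reciprocals
  import Data.Fin.Properties as FinP
  open import Data.Rational using (_+_; _*_; _-_; _≤_)
  open import Data.Rational.Solver
  open +-*-Solver using (solve; _:+_; _:*_; _:-_; _:=_; con)

  sumQ-cong : ∀ {n} {f g : Fin n → ℚ} → (∀ j → f j ≡ g j) → sumQ f ≡ sumQ g
  sumQ-cong {zero} _ = refl
  sumQ-cong {suc n} f≗g = cong₂ _+_ (f≗g fzero) (sumQ-cong (λ j → f≗g (fsuc j)))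

  prodQ-cong : ∀ {n} {f g : Fin n → ℚ} → (∀ j → f j ≡ g j) → prodQ f ≡ prodQ g
  prodQ-cong {zero} _ = refl
  prodQ-cong {suc n} f≗g = cong₂ _*_ (f≗g fzero) (prodQ-cong (λ j → f≗g (fsuc j)))

  private
    except-tail : ∀ {n} {A : Set} (f g : Fin (suc n) → A) j₀ →
                  (∀ j → j ≢ fsuc j₀ → f j ≡ g j) → ∀ j → j ≢ j₀ → f (fsuc j) ≡ g (fsuc j)
    except-tail f g j₀ agree j j≢j₀ = agree (fsuc j) (λ e → j≢j₀ (FinP.suc-injective e))

  sumQ-update : ∀ {n} (f g : Fin n → ℚ) j₀ → (∀ j → j ≢ j₀ → f j ≡ g j) →
                sumQ f ≡ sumQ g + (f j₀ - g j₀)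
  sumQ-update {suc n} f g fzero agree =
    trans (cong (f fzero +_) (sumQ-cong (λ j → agree (fsuc j) (λ ()))))
          (solve 3 (λ a b s → a :+ s := b :+ s :+ (a :- b)) refl
                 (f fzero) (g fzero) (sumQ (λ j → g (fsuc j))))
  sumQ-update {suc n} f g (fsuc j₀) agree =
    trans (cong₂ _+_ (agree fzero (λ ()))
                     (sumQ-update (λ j → f (fsuc j)) (λ j → g (fsuc j)) j₀
                                  (except-tail f g j₀ agree)))
          (sym (ℚP.+-assoc (g fzero) _ _))

  prodQ-update : ∀ {n} (f g : Fin n → ℚ) j₀ → (∀ j → j ≢ j₀ → f j ≡ g j) → f j₀ ≡ 1ℚ →
                 prodQ g ≡ prodQ f * g j₀
  prodQ-update {suc n} f g fzero agree f₀≡1 =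
    trans (cong (g fzero *_) (sym (prodQ-cong (λ j → agree (fsuc j) (λ ())))))
    (trans (solve 2 (λ x p → x :* p := con 1ℚ :* p :* x) refl (g fzero) (prodQ (λ j → f (fsuc j))))
           (cong (λ t → t * prodQ (λ j → f (fsuc j)) * g fzero) (sym f₀≡1)))
  prodQ-update {suc n} f g (fsuc j₀) agree f₀≡1 =
    trans (cong₂ _*_ (sym (agree fzero (λ ())))
                     (prodQ-update (λ j → f (fsuc j)) (λ j → g (fsuc j)) j₀
                                   (except-tail f g j₀ agree) f₀≡1))
          (sym (ℚP.*-assoc (f fzero) _ _))

  sumQ-nonNeg : ∀ {n} (f : Fin n → ℚ) → (∀ j → 0ℚ ≤ f j) → 0ℚ ≤ sumQ f
  sumQ-nonNeg {zero} f _ = ℚP.≤-refl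
  sumQ-nonNeg {suc n} f f≥0 = subst (_≤ sumQ f) (ℚP.+-identityˡ 0ℚ)
    (ℚP.+-mono-≤ (f≥0 fzero) (sumQ-nonNeg (λ j → f (fsuc j)) (λ j → f≥0 (fsuc j))))

  prodQ-unit : ∀ {n} (f : Fin n → ℚ) → (∀ j → 0ℚ ≤ f j × f j ≤ 1ℚ) → 0ℚ ≤ prodQ f × prodQ f ≤ 1ℚ
  prodQ-unit {zero} f _ = 0≤1 , ℚP.≤-refl
  prodQ-unit {suc n} f f∈[0,1] =
    *-nonNeg f₀≥0 p≥0 ,
    ℚP.≤-trans (subst (prodQ f ≤_) (ℚP.*-identityʳ (f fzero)) (*-monoˡ-≤ (f fzero) f₀≥0 p≤1)) f₀≤1
    where
    f₀≥0 = proj₁ (f∈[0,1] fzero)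
    f₀≤1 = proj₂ (f∈[0,1] fzero)
    p≥0 = proj₁ (prodQ-unit (λ j → f (fsuc j)) (λ j → f∈[0,1] (fsuc j)))
    p≤1 = proj₂ (prodQ-unit (λ j → f (fsuc j)) (λ j → f∈[0,1] (fsuc j)))

  prodℕ-positive : ∀ {n} (f : Fin n → ℕ) → (∀ j → 1 ℕ.≤ f j) → 1 ℕ.≤ prodℕ f
  prodℕ-positive {zero} f _ = s≤s z≤n
  prodℕ-positive {suc n} f f≥1 =
    1≤-* (f≥1 fzero) (prodℕ-positive (λ j → f (fsuc j)) (λ j → f≥1 (fsuc j)))

module Denominators where

  open Fractions
  open Reciprocals
  open import Data.Nat.Divisibility using (_∣_; divides; *-pres-∣; ∣-refl; m∣m*n; n∣m*n; ∣-trans)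
  open import Data.Product using (Σ)
  open import Data.Rational using (_+_; _*_; _≤_; _<_)

  HasDenominator : ℕ → ℚ → Set
  HasDenominator D q = Σ ℕ (λ n → q ≡ ratio n D)

  denom-+ : ∀ {D q r} → 1 ℕ.≤ D → HasDenominator D q → HasDenominator D r → HasDenominator D (q + r)
  denom-+ {D} D≥1 (n , refl) (n′ , refl) = n ℕ.+ n′ , ratio-+-same n n′ D D≥1

  denom-* : ∀ {D E q r} → 1 ℕ.≤ D → 1 ℕ.≤ E →
            HasDenominator D q → HasDenominator E r → HasDenominator (D ℕ.* E) (q * r)
  denom-* {D} {E} D≥1 E≥1 (n , refl) (n′ , refl) = n ℕ.* n′ , ratio-* n D n′ E D≥1 E≥1

  denom-∣ : ∀ {D E q} → 1 ℕ.≤ D → 1 ℕ.≤ E → D ∣ E → HasDenominator D q → HasDenominator E q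
  denom-∣ {D} {E} D≥1 E≥1 (divides t E≡tD) (n , refl) =
    n ℕ.* t , ratio-cong n D (n ℕ.* t) E D≥1 E≥1
                (trans (cong (n ℕ.*_) E≡tD) (sym (ℕP.*-assoc n t D)))

  sumQ-denom : ∀ {n D} (f : Fin n → ℚ) → 1 ℕ.≤ D →
               (∀ j → HasDenominator D (f j)) → HasDenominator D (sumQ f)
  sumQ-denom {zero} {D} f D≥1 _ = 0 , ratio-cong 0 1 0 D (s≤s z≤n) D≥1 refl
  sumQ-denom {suc n} f D≥1 denom =
    denom-+ D≥1 (denom fzero) (sumQ-denom (λ j → f (fsuc j)) D≥1 (λ j → denom (fsuc j)))

  prodQ-denom : ∀ {n} (f : Fin n → ℚ) (d : Fin n → ℕ) → (∀ j → 1 ℕ.≤ d j) →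
                (∀ j → HasDenominator (d j) (f j)) → HasDenominator (prodℕ d) (prodQ f)
  prodQ-denom {zero} f d _ _ = 1 , refl
  prodQ-denom {suc n} f d d≥1 denom =
    denom-* (d≥1 fzero) (FinSums.prodℕ-positive (λ j → d (fsuc j)) (λ j → d≥1 (fsuc j)))
      (denom fzero)
      (prodQ-denom (λ j → f (fsuc j)) (λ j → d (fsuc j)) (λ j → d≥1 (fsuc j)) (λ j → denom (fsuc j)))

  denom-gap : ∀ {D q} → 1 ℕ.≤ D → HasDenominator D q → 1ℚ < q → 1ℚ + recip D ≤ q
  denom-gap {D} D≥1 (n , refl) 1<q =
    subst (_≤ ratio n D) (sym (ratio-+ 1 1 1 D (s≤s z≤n) D≥1))
      (ratio-mono-≤ (1 ℕ.* D ℕ.+ 1 ℕ.* 1) (1 ℕ.* D) n D (1≤-* {1} (s≤s z≤n) D≥1) D≥1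
        (subst₂ ℕ._≤_ (e₁ D) (e₂ n D) (ℕP.*-monoˡ-≤ D D<n)))
    where
    D<n : D ℕ.< n
    D<n = subst₂ ℕ._<_ (ℕP.*-identityˡ D) (ℕP.*-identityʳ n)
            (ratio-cancel-< 1 1 n D (s≤s z≤n) D≥1 1<q)
    e₁ : ∀ D → suc D ℕ.* D ≡ (1 ℕ.* D ℕ.+ 1 ℕ.* 1) ℕ.* D
    e₁ = solve-∀
    e₂ : ∀ n D → n ℕ.* D ≡ n ℕ.* (1 ℕ.* D)
    e₂ = solve-∀

  ∣-prodℕ : ∀ {n} (f : Fin n → ℕ) i → f i ∣ prodℕ f
  ∣-prodℕ f fzero = m∣m*n _
  ∣-prodℕ f (fsuc i) = ∣-trans (∣-prodℕ (λ j → f (fsuc j)) i) (n∣m*n (f fzero))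

  prodℕ-∣ : ∀ {n} (f g : Fin n → ℕ) → (∀ j → f j ∣ g j) → prodℕ f ∣ prodℕ g
  prodℕ-∣ {zero} f g _ = ∣-refl
  prodℕ-∣ {suc n} f g f∣g =
    *-pres-∣ (f∣g fzero) (prodℕ-∣ (λ j → f (fsuc j)) (λ j → g (fsuc j)) (λ j → f∣g (fsuc j)))

module Stepwise where

  open import Data.Fin using (fromℕ<)
  open import Data.Fin.Properties using (toℕ-fromℕ<)
  open import Data.Sum using (inj₁; inj₂)
  open import Relation.Binary.Definitions using (Reflexive; Transitive)

  stepwise : ∀ {A : Set} (_≼_ : A → A → Set) → Reflexive _≼_ → Transitive _≼_ →
             ∀ {R} (h : ℕ → A) → (∀ (j : Fin R) → h (toℕ j) ≼ h (suc (toℕ j))) →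
             ∀ {N} M → N ℕ.≤ M → M ℕ.≤ R → h N ≼ h M
  stepwise _≼_ refl′ trans′ h step zero z≤n _ = refl′
  stepwise _≼_ refl′ trans′ h step (suc M) N≤1+M M<R with ℕP.m≤n⇒m<n∨m≡n N≤1+M
  ... | inj₂ refl = refl′
  ... | inj₁ (s≤s N≤M) =
    trans′ (stepwise _≼_ refl′ trans′ h step M N≤M (ℕP.<⇒≤ M<R))
           (subst (λ n → h n ≼ h (suc n)) (toℕ-fromℕ< M<R) (step (fromℕ< M<R)))

module PrefixTail where

  open Reciprocals
  open SumDomination using (sumℚ)
  open ExtremalProduct using (TailCondition)
  open import Data.Bool using (true; false; if_then_else_)
  open import Data.List using (tabulate; map)
  open import Data.Nat.ListAction using (product)
  open import Data.Nat using (_<ᵇ_)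
  open import Data.Rational using (_≤_)
  open import Data.Unit using (tt)
  open import Data.Empty using (⊥-elim)

  -- Moving the cut from N to N + 1 switches on exactly the index N.
  <ᵇ-irrefl : ∀ n → (n <ᵇ n) ≡ false
  <ᵇ-irrefl zero = refl
  <ᵇ-irrefl (suc n) = <ᵇ-irrefl n

  <ᵇ-suc : ∀ n → (n <ᵇ suc n) ≡ true
  <ᵇ-suc zero = refl
  <ᵇ-suc (suc n) = <ᵇ-suc n

  <ᵇ-suc-≢ : ∀ n N → n ≢ N → (n <ᵇ suc N) ≡ (n <ᵇ N)
  <ᵇ-suc-≢ zero zero n≢N = ⊥-elim (n≢N refl)
  <ᵇ-suc-≢ zero (suc N) _ = refl
  <ᵇ-suc-≢ (suc n) zero _ = refl
  <ᵇ-suc-≢ (suc n) (suc N) n≢N = <ᵇ-suc-≢ n N (λ e → n≢N (cong suc e))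

  prefixProd : ∀ {r} → (Fin r → ℕ) → ℕ → ℕ
  prefixProd f N = prodℕ (λ j → if toℕ j <ᵇ N then f j else 1)

  tailRecipSum : ∀ {r} → (Fin r → ℕ) → ℕ → ℚ
  tailRecipSum f N = sumQ (λ j → if toℕ j <ᵇ N then 0ℚ else recip (f j))

  prodℕ-ones : ∀ {n} → prodℕ {n} (λ _ → 1) ≡ 1
  prodℕ-ones {zero} = refl
  prodℕ-ones {suc n} = cong (1 ℕ.*_) (prodℕ-ones {n})

  sumRecip-tabulate : ∀ {n} (f : Fin n → ℕ) → sumℚ (map recip (tabulate f)) ≡ sumQ (λ j → recip (f j))
  sumRecip-tabulate {zero} f = refl
  sumRecip-tabulate {suc n} f = cong (recip (f fzero) ℚ.+_) (sumRecip-tabulate (λ j → f (fsuc j)))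

  product-tabulate : ∀ {n} (f : Fin n → ℕ) → product (tabulate f) ≡ prodℕ f
  product-tabulate {zero} f = refl
  product-tabulate {suc n} f = cong (f fzero ℕ.*_) (product-tabulate (λ j → f (fsuc j)))

  -- Shifting the cut by one peels the first value off f.
  tail-condition : ∀ {r} P (f : Fin r → ℕ) →
                   (∀ N → N ℕ.< r → recip (P ℕ.* prefixProd f N) ≤ tailRecipSum f N) →
                   TailCondition P (tabulate f)
  tail-condition {zero} P f _ = tt
  tail-condition {suc r} P f bound =
    subst₂ _≤_ (cong recip (trans (cong (P ℕ.*_) (prodℕ-ones {suc r})) (ℕP.*-identityʳ P)))
               (sym (sumRecip-tabulate f)) (bound 0 (s≤s z≤n)) ,
    tail-condition (P ℕ.* f fzero) (λ j → f (fsuc j)) (λ N N<r →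
      subst₂ _≤_ (cong recip (sym (ℕP.*-assoc P (f fzero) _))) (ℚP.+-identityˡ _) (bound (suc N) (s≤s N<r)))

-- When index j enters, S drops by at most 1/mⱼ; hence S is
-- antitone and S(N) ≤ S(R) + Σ_{j > N} 1/mⱼ.  Moreover S(N) is a fraction with
-- denominator a₁⋯a_k · m₁⋯m_N.  Together with S(R) ≤ 1 < S(R-1) this yields
-- the tail condition 1/(a m₁⋯m_N) ≤ Σ_{j > N} 1/mⱼ for every N < R.
module WeightedSums (R k : ℕ) (m : Fin R → ℕ) (c : Fin R → Fin k) (a b : Fin k → ℕ)
                    (m≥1 : ∀ j → 1 ℕ.≤ m j) (a≥1 : ∀ i → 1 ℕ.≤ a i) (b≤a : ∀ i → b i ℕ.≤ a i) where

  open Fractions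
  open Reciprocals
  open FinSums
  open Denominators
  open PrefixTail
  open Stepwise
  open import Data.Bool using (Bool; true; false; if_then_else_; _∧_)
  open import Data.Bool.Properties using (∧-zeroʳ; ∧-identityʳ)
  open import Data.Fin.Properties using (toℕ-injective) renaming (_≟_ to _≟ᶠ_)
  open import Relation.Nullary.Decidable using (Dec; ⌊_⌋; yes; no)
  open import Data.Nat using (_<ᵇ_; _∸_)
  open import Data.Nat.Divisibility using (_∣_; ∣-refl; 1∣_; *-pres-∣)
  open import Data.Rational using (_+_; _*_; _-_; -_; _≤_; _<_)
  open import Data.Rational.Solver
  open +-*-Solver using (solve; _:+_; _:*_; _:-_; _:=_; con)
  open import Data.Empty using (⊥-elim)

  S : ℕ → ℚ
  S = weightedSum R k m c a b

  w : Fin k → ℚ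
  w i = ratio (b i) (a i)

  pp : Fin k → ℕ → ℚ
  pp i N = partProd R k m c i N

  factor : ℕ → Fin k → Fin R → ℚ
  factor N i j = if ⌊ c j ≟ᶠ i ⌋ ∧ (toℕ j <ᵇ N) then 1ℚ - recip (m j) else 1ℚ

  guarded : Bool → ℕ → ℚ
  guarded B M = if B then 1ℚ - recip M else 1ℚ

  guarded-unit : ∀ B M → 1 ℕ.≤ M → 0ℚ ≤ guarded B M × guarded B M ≤ 1ℚ
  guarded-unit false M _ = 0≤1 , ℚP.≤-refl
  guarded-unit true M M≥1 rewrite 1-recip M M≥1 =
    ratio-mono-≤ 0 1 (M ∸ 1) M (s≤s z≤n) M≥1 z≤n ,
    ratio-mono-≤ (M ∸ 1) M 1 1 M≥1 (s≤s z≤n)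
      (subst₂ ℕ._≤_ (sym (ℕP.*-identityʳ _)) (sym (ℕP.*-identityˡ _)) (ℕP.m∸n≤m M 1))

  guarded-denominator : ∀ B M → 1 ℕ.≤ M → HasDenominator (if B then M else 1) (guarded B M)
  guarded-denominator false M _ = 1 , refl
  guarded-denominator true M M≥1 = M ∸ 1 , 1-recip M M≥1

  if-positive : ∀ B M → 1 ℕ.≤ M → 1 ℕ.≤ (if B then M else 1)
  if-positive false M _ = s≤s z≤n
  if-positive true M M≥1 = M≥1

  restrict-∣ : ∀ B t M → (if B ∧ t then M else 1) ∣ (if t then M else 1)
  restrict-∣ false t M = 1∣ _
  restrict-∣ true t M = ∣-refl

  w-unit : ∀ i → 0ℚ ≤ w i × w i ≤ 1ℚ
  w-unit i = ratio-mono-≤ 0 1 (b i) (a i) (s≤s z≤n) (a≥1 i) z≤n ,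
             ratio-mono-≤ (b i) (a i) 1 1 (a≥1 i) (s≤s z≤n)
               (subst₂ ℕ._≤_ (sym (ℕP.*-identityʳ _)) (sym (ℕP.*-identityˡ _)) (b≤a i))

  pp-unit : ∀ i N → 0ℚ ≤ pp i N × pp i N ≤ 1ℚ
  pp-unit i N = prodQ-unit (factor N i) (λ j → guarded-unit (⌊ c j ≟ᶠ i ⌋ ∧ (toℕ j <ᵇ N)) (m j) (m≥1 j))

  pp-step : ∀ j i → pp i (suc (toℕ j)) ≡ pp i (toℕ j) * guarded ⌊ c j ≟ᶠ i ⌋ (m j)
  pp-step j i = trans (prodQ-update (factor N i) (factor (suc N) i) j agree old) (cong (pp i N *_) new)
    where
    N = toℕ j
    B = ⌊ c j ≟ᶠ i ⌋
    agree : ∀ j′ → j′ ≢ j → factor N i j′ ≡ factor (suc N) i j′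
    agree j′ j′≢j = cong (λ t → guarded (⌊ c j′ ≟ᶠ i ⌋ ∧ t) (m j′))
                         (sym (<ᵇ-suc-≢ (toℕ j′) N (λ e → j′≢j (toℕ-injective e))))
    old : factor N i j ≡ 1ℚ
    old = cong (λ t → guarded t (m j)) (trans (cong (B ∧_) (<ᵇ-irrefl N)) (∧-zeroʳ B))
    new : factor (suc N) i j ≡ guarded B (m j)
    new = cong (λ t → guarded t (m j)) (trans (cong (B ∧_) (<ᵇ-suc N)) (∧-identityʳ B))

  loss : Fin R → ℚ
  loss j = w (c j) * pp (c j) (toℕ j) * recip (m j)

  S-step : ∀ j → S (toℕ j) ≡ S (suc (toℕ j)) + loss j
  S-step j = trans (sumQ-update before after (c j) agree) (cong (S (suc N) +_) drop)
    where
    N = toℕ j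
    before after : Fin k → ℚ
    before i = w i * pp i N
    after i = w i * pp i (suc N)
    other-factor : ∀ {i} (d : Dec (c j ≡ i)) → i ≢ c j → guarded ⌊ d ⌋ (m j) ≡ 1ℚ
    other-factor (yes cj≡i) i≢cj = ⊥-elim (i≢cj (sym cj≡i))
    other-factor (no _) _ = refl
    agree : ∀ i → i ≢ c j → before i ≡ after i
    agree i i≢cj = sym (begin
      w i * pp i (suc N)                           ≡⟨ cong (w i *_) (pp-step j i) ⟩
      w i * (pp i N * guarded ⌊ c j ≟ᶠ i ⌋ (m j))  ≡⟨ cong (λ t → w i * (pp i N * t))
                                                            (other-factor (c j ≟ᶠ i) i≢cj) ⟩
      w i * (pp i N * 1ℚ)                          ≡⟨ cong (w i *_) (ℚP.*-identityʳ (pp i N)) ⟩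
      w i * pp i N                                 ∎)
      where open ≡-Reasoning
    own-factor : ∀ d → guarded ⌊ d ⌋ (m j) ≡ 1ℚ - recip (m j)
    own-factor (yes _) = refl
    own-factor (no c≢c) = ⊥-elim (c≢c refl)
    drop : before (c j) - after (c j) ≡ loss j
    drop = trans (cong (λ t → before (c j) - w (c j) * t)
                       (trans (pp-step j (c j)) (cong (pp (c j) N *_) (own-factor (c j ≟ᶠ c j)))))
                 (solve 3 (λ w f r → w :* f :- w :* (f :* (con 1ℚ :- r)) := w :* f :* r) refl
                        (w (c j)) (pp (c j) N) (recip (m j)))

  loss-bounds : ∀ j → 0ℚ ≤ loss j × loss j ≤ recip (m j)
  loss-bounds j = *-nonNeg wp≥0 (recip-nonNeg (m j)) ,
                  subst (loss j ≤_) (ℚP.*-identityˡ _) (*-monoʳ-≤ (recip (m j)) (recip-nonNeg (m j)) wp≤1)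
    where
    i = c j
    wp≥0 : 0ℚ ≤ w i * pp i (toℕ j)
    wp≥0 = *-nonNeg (proj₁ (w-unit i)) (proj₁ (pp-unit i (toℕ j)))
    wp≤1 : w i * pp i (toℕ j) ≤ 1ℚ
    wp≤1 = ℚP.≤-trans (subst (w i * pp i (toℕ j) ≤_) (ℚP.*-identityʳ (w i))
                        (*-monoˡ-≤ (w i) (proj₁ (w-unit i)) (proj₂ (pp-unit i (toℕ j)))))
                      (proj₂ (w-unit i))

  tail-step : ∀ j → tailRecipSum m (toℕ j) ≡ tailRecipSum m (suc (toℕ j)) + recip (m j)
  tail-step j = trans (sumQ-update before after j agree) (cong (tailRecipSum m (suc N) +_) drop)
    where
    N = toℕ j
    term : Bool → Fin R → ℚ
    term t j′ = if t then 0ℚ else recip (m j′)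
    before after : Fin R → ℚ
    before j′ = term (toℕ j′ <ᵇ N) j′
    after j′ = term (toℕ j′ <ᵇ suc N) j′
    agree : ∀ j′ → j′ ≢ j → before j′ ≡ after j′
    agree j′ j′≢j = cong (λ t → term t j′) (sym (<ᵇ-suc-≢ (toℕ j′) N (λ e → j′≢j (toℕ-injective e))))
    drop : before j - after j ≡ recip (m j)
    drop = trans (cong₂ (λ s t → term s j - term t j) (<ᵇ-irrefl N) (<ᵇ-suc N))
                 (solve 1 (λ x → x :- con 0ℚ := x) refl (recip (m j)))

  S-antitone : ∀ {N} M → N ℕ.≤ M → M ℕ.≤ R → S M ≤ S N
  S-antitone = stepwise (λ x y → y ≤ x) ℚP.≤-refl (λ x≥y y≥z → ℚP.≤-trans y≥z x≥y) S step
    where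
    step : ∀ j → S (suc (toℕ j)) ≤ S (toℕ j)
    step j = subst₂ _≤_ (ℚP.+-identityʳ _) (sym (S-step j))
               (ℚP.+-monoʳ-≤ (S (suc (toℕ j))) (proj₁ (loss-bounds j)))

  -- S(N) - Σ_{j > N} 1/mⱼ is nondecreasing, since each loss is at most 1/mⱼ.
  S-below-tail : ∀ N → N ℕ.≤ R → S N ≤ S R + tailRecipSum m N
  S-below-tail N N≤R = begin
    S N        ≡⟨ split (S N) (t N) ⟩
    h N + t N  ≤⟨ ℚP.+-monoˡ-≤ (t N) h-mono ⟩
    h R + t N  ≤⟨ ℚP.+-monoˡ-≤ (t N) hR≤SR ⟩
    S R + t N  ∎
    where
    open ℚP.≤-Reasoning
    t : ℕ → ℚ
    t = tailRecipSum m
    h : ℕ → ℚ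
    h N = S N - t N
    split : ∀ s u → s ≡ s - u + u
    split = solve 2 (λ s u → s := s :- u :+ u) refl
    h-step : ∀ j → h (toℕ j) ≤ h (suc (toℕ j))
    h-step j = 0≤-⇒≤ (subst (0ℚ ≤_) diff (≤⇒0≤- (proj₂ (loss-bounds j))))
      where
      n = toℕ j
      diff : recip (m j) - loss j ≡ h (suc n) - h n
      diff = trans (solve 4 (λ s u ℓ r → r :- ℓ := (s :- u) :- ((s :+ ℓ) :- (u :+ r))) refl
                          (S (suc n)) (t (suc n)) (loss j) (recip (m j)))
                   (cong₂ (λ x y → h (suc n) - (x - y)) (sym (S-step j)) (sym (tail-step j)))
    tR≥0 : 0ℚ ≤ t R
    tR≥0 = sumQ-nonNeg _ term≥0
      where
      term≥0 : ∀ j → 0ℚ ≤ (if toℕ j <ᵇ R then 0ℚ else recip (m j))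
      term≥0 j with toℕ j <ᵇ R
      ... | true = ℚP.≤-refl
      ... | false = recip-nonNeg (m j)
    h-mono : h N ≤ h R
    h-mono = stepwise _≤_ ℚP.≤-refl ℚP.≤-trans h h-step R N≤R ℕP.≤-refl
    hR≤SR : h R ≤ S R
    hR≤SR = 0≤-⇒≤ (subst (0ℚ ≤_) (solve 2 (λ s u → u := s :- (s :- u)) refl (S R) (t R)) tR≥0)

  denominator-positive : ∀ N → 1 ℕ.≤ prodℕ a ℕ.* prefixProd m N
  denominator-positive N =
    1≤-* (prodℕ-positive a a≥1) (prodℕ-positive _ (λ j → if-positive (toℕ j <ᵇ N) (m j) (m≥1 j)))

  -- S(N) is a fraction with denominator a₁⋯a_k · m₁⋯m_N: its i-th term has
  -- denominator aᵢ ∏_{j ≤ N, j ∈ Jᵢ} mⱼ, which divides it.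
  S-denominator : ∀ N → HasDenominator (prodℕ a ℕ.* prefixProd m N) (S N)
  S-denominator N = sumQ-denom _ (denominator-positive N) (λ i →
    denom-∣ (1≤-* (a≥1 i) (den≥1 i)) (denominator-positive N)
      (*-pres-∣ (∣-prodℕ a i) (prodℕ-∣ (den i) _ (λ j → restrict-∣ ⌊ c j ≟ᶠ i ⌋ (toℕ j <ᵇ N) (m j))))
      (denom-* (a≥1 i) (den≥1 i) (b i , refl)
        (prodQ-denom (factor N i) (den i) (den-pos i)
          (λ j → guarded-denominator (⌊ c j ≟ᶠ i ⌋ ∧ (toℕ j <ᵇ N)) (m j) (m≥1 j)))))
    where
    den : Fin k → Fin R → ℕ
    den i j = if ⌊ c j ≟ᶠ i ⌋ ∧ (toℕ j <ᵇ N) then m j else 1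
    den-pos : ∀ i j → 1 ℕ.≤ den i j
    den-pos i j = if-positive (⌊ c j ≟ᶠ i ⌋ ∧ (toℕ j <ᵇ N)) (m j) (m≥1 j)
    den≥1 : ∀ i → 1 ℕ.≤ prodℕ (den i)
    den≥1 i = prodℕ-positive (den i) (den-pos i)

  tail-bound : S R ≤ 1ℚ → 1ℚ < S (R ∸ 1) →
               ∀ N → N ℕ.< R → recip (prodℕ a ℕ.* prefixProd m N) ≤ tailRecipSum m N
  tail-bound S-R≤1 1<S-R-1 N N<R = cancel-1 (begin
    1ℚ + recip D                ≤⟨ denom-gap D≥1 (S-denominator N) 1<S-N ⟩
    S N                         ≤⟨ S-below-tail N (ℕP.<⇒≤ N<R) ⟩
    S R + tailRecipSum m N      ≤⟨ ℚP.+-monoˡ-≤ (tailRecipSum m N) S-R≤1 ⟩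
    1ℚ + tailRecipSum m N       ∎)
    where
    open ℚP.≤-Reasoning
    D = prodℕ a ℕ.* prefixProd m N
    D≥1 : 1 ℕ.≤ D
    D≥1 = denominator-positive N
    1<S-N : 1ℚ < S N
    1<S-N = ℚP.<-≤-trans 1<S-R-1 (S-antitone (R ∸ 1) (ℕP.∸-monoˡ-≤ 1 N<R) (ℕP.m∸n≤m R 1))
    cancel-1 : ∀ {x y} → 1ℚ + x ≤ 1ℚ + y → x ≤ y
    cancel-1 {x} {y} le = subst₂ _≤_ (e x) (e y) (ℚP.+-monoˡ-≤ (- 1ℚ) le)
      where
      e : ∀ z → 1ℚ + z - 1ℚ ≡ z
      e = solve 1 (λ z → con 1ℚ :+ z :- con 1ℚ := z) refl

open import Data.Nat using (ℕ; _≤_; _<_; _∸_; _+_; _*_)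
open import Data.Fin using (Fin) renaming (_≤_ to _≤ᶠ_)
open import Data.Rational using () renaming (_≤_ to _≤ℚ_; _<_ to _<ℚ_)
open import Data.Rational using (1ℚ)
open import Data.List using (tabulate)
open import Data.List.Properties using (length-tabulate)
import Data.List.Relation.Unary.All.Properties as All
import Data.List.Relation.Unary.AllPairs.Properties as AllPairs
open ExtremalProduct using (greedyBound; extremal-product)
open GreedyVersusF using (greedyBound≤F)
open PrefixTail using (tail-condition; product-tabulate)

-- With a = a₁⋯a_k, the weighted sums give the tail condition for the sorted
-- values m₁ ≤ … ≤ m_R (started at a), so a m₁⋯m_R is at most the extremal
-- value greedyBound a R, which is at most F_R(a + 1).
lemma5 : (k R : ℕ) → 1 ≤ k → 1 ≤ R →
    (m : Fin R → ℕ) → (∀ j → 1 < m j) → (∀ j j′ → j ≤ᶠ j′ → m j ≤ m j′) →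
    (c : Fin R → Fin k) →
    (a b : Fin k → ℕ) → (∀ i → 1 ≤ a i) → (∀ i → 1 ≤ b i) → (∀ i → b i ≤ a i) →
    weightedSum R k m c a b R ≤ℚ 1ℚ →
    1ℚ <ℚ weightedSum R k m c a b (R ∸ 1) →
    prodℕ a * prodℕ m ≤ F R (prodℕ a + 1)
lemma5 k (suc r) _ _ m m>1 m-mono c a b a≥1 _ b≤a S-R≤1 1<S-R-1 =
  subst (prodℕ a * prodℕ m ≤_) (cong (F (suc r)) (ℕP.+-comm 1 (prodℕ a)))
    (ℕP.≤-trans bounded (greedyBound≤F r (prodℕ a)))
  where
  m≥1 : ∀ j → 1 ≤ m j
  m≥1 j = ℕP.<⇒≤ (m>1 j)
  open WeightedSums (suc r) k m c a b m≥1 a≥1 b≤a using (tail-bound)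
  bounded : prodℕ a * prodℕ m ≤ greedyBound (prodℕ a) (suc r)
  bounded = subst₂ (λ p n → prodℕ a * p ≤ greedyBound (prodℕ a) n)
                   (product-tabulate m) (length-tabulate m)
    (extremal-product (prodℕ a) (tabulate m) (FinSums.prodℕ-positive a a≥1)
      (tail-condition (prodℕ a) m (tail-bound S-R≤1 1<S-R-1))
      (AllPairs.tabulate⁺-< (λ i<j → m-mono _ _ (ℕP.<⇒≤ i<j)))
      (All.tabulate⁺ m≥1))
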